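{- Let $D$ be a digraph. Then there exists a maximal cycle family $\mathcal{C}$ in $D$ such that, writing $A:=D-\mathcal{C}$, we have $xy\notin E(A)$ for every $C\in\mathcal{C}$ and every pair of distinct vertices $x,y\in V(C)$.
   Context: A digraph is finite, has no loops and, between two distinct vertices, at most one edge in each direction; $xy$ denotes the directed edge from $x$ to $y$. A cycle family is a collection of pairwise edge-disjoint directed cycles; $D-\mathcal{C}$ is $D$ with all edges of members of $\mathcal{C}$ deleted; $\mathcal{C}$ is maximal if $D-\mathcal{C}$ contains no directed cycle. -}

module Defs where

open import Data.Nat using (ℕ; _≥_)
open import Data.Fin using (Fin)
open import Data.List using (List; []; _∷_; length)
open import Data.List.Membership.Propositional using (_∈_; _∉_)
open import Data.List.Relation.Unary.All using (All)
open import Data.List.Relation.Unary.Any using (Any)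
open import Data.List.Relation.Unary.Unique.Propositional using (Unique)
open import Data.List.Relation.Unary.AllPairs using (AllPairs)
open import Data.Product using (Σ; ∃; _×_; _,_)
open import Relation.Nullary using (¬_; Dec)

-- Between two distinct vertices there is at most one edge in each direction
-- automatically (edges are a relation).
record Digraph (n : ℕ) : Set₁ where
  field
    Edge     : Fin n → Fin n → Set
    edge?    : ∀ x y → Dec (Edge x y)
    loopless : ∀ x → ¬ Edge x x
open Digraph public

-- cyclic consecutive pairs of a vertex sequence v0 … v(k-1):
-- (v0,v1), …, (v(k-2),v(k-1)), (v(k-1),v0)
arcsFrom : {A : Set} → A → List A → List (A × A)
arcsFrom first []           = []
arcsFrom first (a ∷ [])     = (a , first) ∷ []
arcsFrom first (a ∷ b ∷ r)  = (a , b) ∷ arcsFrom first (b ∷ r)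

arcs : {A : Set} → List A → List (A × A)
arcs []       = []
arcs (v ∷ vs) = arcsFrom v (v ∷ vs)

IsCycleIn : {n : ℕ} → (Fin n → Fin n → Set) → List (Fin n) → Set
IsCycleIn R vs = (length vs ≥ 2) × Unique vs × All (λ { (x , y) → R x y }) (arcs vs)

HasCycle : {n : ℕ} → (Fin n → Fin n → Set) → Set
HasCycle R = ∃ λ vs → IsCycleIn R vs

Covered : {n : ℕ} → List (List (Fin n)) → Fin n → Fin n → Set
Covered F x y = Any (λ C → (x , y) ∈ arcs C) F

EdgeDisjoint : {n : ℕ} → List (List (Fin n)) → Set
EdgeDisjoint F = AllPairs (λ C C' → ∀ x y → (x , y) ∈ arcs C → (x , y) ∉ arcs C') F

IsCycleFamily : {n : ℕ} → Digraph n → List (List (Fin n)) → Set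
IsCycleFamily D F = All (IsCycleIn (Edge D)) F × EdgeDisjoint F

RemEdge : {n : ℕ} → Digraph n → List (List (Fin n)) → Fin n → Fin n → Set
RemEdge D F x y = Edge D x y × ¬ Covered F x y

IsMaximalCycleFamily : {n : ℕ} → Digraph n → List (List (Fin n)) → Set
IsMaximalCycleFamily D F = IsCycleFamily D F × ¬ HasCycle (RemEdge D F)

{-# OPTIONS --safe #-}
-- Greedily delete chordless cycles of the remaining digraph A = D − F: a cycle C of A
-- whose vertices span no edge of A except the arcs of C. Once C is deleted, no edge of A
-- joins two of its vertices, and this persists since later steps only delete more edges.
-- A chord xy of a cycle through y … x closes the strictly shorter cycle y … x y, so every
-- cycle of A leads to a chordless one. Each step deletes an edge, and the search for a
-- cycle is finite because a cycle repeats no vertex.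
module Submission where

open import Defs
open import Data.Nat using (ℕ; zero; suc; _≤_; _<_; z≤n; s≤s; _≤?_)
open import Data.Nat.Induction using (<-wellFounded)
open import Data.Nat.Properties using (≮⇒≥; m≤n+m; +-monoʳ-<)
open import Data.Fin using (Fin; zero; suc)
open import Data.Fin.Properties using (any?; pigeonhole; <⇒≢) renaming (_≟_ to _≟ᶠ_)
open import Data.List using (List; []; _∷_; [_]; length; _++_; lookup; allFin; cartesianProduct; filter)
open import Data.List.Properties using (++-assoc; ++-identityʳ; length-++; filter-notAll; filter-reject)
open import Data.List.Membership.Propositional using (_∈_; _∉_; lose)
open import Data.List.Membership.Propositional.Properties using (∈-++⁺ʳ; ∈-∃++; ∈-allFin; ∈-cartesianProduct⁺; ∈-lookup; ∈-filter⁺)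
open import Data.List.Relation.Unary.All as All using (All; []; _∷_)
open import Data.List.Relation.Unary.All.Properties using (++⁺; ++⁻ˡ)
open import Data.List.Relation.Unary.Any as Any using (here; there)
open import Data.List.Relation.Unary.AllPairs using ([]; _∷_)
open import Data.List.Relation.Unary.Unique.Propositional using (Unique)
open import Data.List.Relation.Binary.Permutation.Propositional using (_↭_; ↭-refl; ↭⇒↭ₛ)
open import Data.List.Relation.Binary.Permutation.Propositional.Properties using (++-comm; ↭-length; All-resp-↭; ∈-resp-↭)
import Data.List.Relation.Binary.Permutation.Setoid.Properties as Permutationₛ
import Data.List.Membership.DecPropositional as MembershipDec
import Data.List.Relation.Unary.Unique.DecPropositional as UniqueDec
open import Data.Product using (∃; ∃₂; _×_; _,_; proj₁; proj₂; uncurry)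
open import Data.Product.Properties using (≡-dec)
open import Function using (_∘_)
open import Induction.WellFounded using (Acc; acc)
open import Relation.Binary.PropositionalEquality using (_≡_; _≢_; refl; sym; trans; cong; subst; setoid)
open import Relation.Binary.Definitions using () renaming (Decidable to Decidable₂)
open import Relation.Nullary using (¬_; Dec; yes; no; contradiction)
open import Relation.Nullary.Decidable using (_×-dec_; ¬?; decidable-stable)
open import Relation.Unary using (Decidable; _⊆_)

module _ {A : Set} where

  pathArcs : List A → List (A × A)
  pathArcs []          = []
  pathArcs (a ∷ [])    = []
  pathArcs (a ∷ b ∷ r) = (a , b) ∷ pathArcs (b ∷ r)

  arcsFrom-pathArcs : (v : A) (vs : List A) → arcsFrom v vs ≡ pathArcs (vs ++ [ v ])
  arcsFrom-pathArcs v []          = refl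
  arcsFrom-pathArcs v (a ∷ [])    = refl
  arcsFrom-pathArcs v (a ∷ b ∷ r) = cong ((a , b) ∷_) (arcsFrom-pathArcs v (b ∷ r))

  pathArcs-++ : (l : List A) (z : A) (m : List A) →
                pathArcs (l ++ z ∷ m) ≡ pathArcs (l ++ [ z ]) ++ pathArcs (z ∷ m)
  pathArcs-++ []           z m = refl
  pathArcs-++ (u ∷ [])     z m = refl
  pathArcs-++ (u ∷ u' ∷ l) z m = cong ((u , u') ∷_) (pathArcs-++ (u' ∷ l) z m)

  arcs-++ : (a : A) (as : List A) (b : A) (bs : List A) →
            arcs (a ∷ as ++ b ∷ bs) ≡ pathArcs (a ∷ as ++ [ b ]) ++ pathArcs (b ∷ bs ++ [ a ])
  arcs-++ a as b bs = begin
    arcs (a ∷ as ++ b ∷ bs)                        ≡⟨ arcsFrom-pathArcs a (a ∷ as ++ b ∷ bs) ⟩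
    pathArcs ((a ∷ as ++ b ∷ bs) ++ [ a ])         ≡⟨ cong pathArcs (++-assoc (a ∷ as) (b ∷ bs) [ a ]) ⟩
    pathArcs (a ∷ as ++ b ∷ bs ++ [ a ])           ≡⟨ pathArcs-++ (a ∷ as) b (bs ++ [ a ]) ⟩
    pathArcs (a ∷ as ++ [ b ]) ++ pathArcs (b ∷ bs ++ [ a ]) ∎
    where open Relation.Binary.PropositionalEquality.≡-Reasoning

  closing-arc : (y : A) (b : List A) (x : A) → (x , y) ∈ arcs (y ∷ b ++ [ x ])
  closing-arc y b x rewrite arcs-++ y b x [] = ∈-++⁺ʳ (pathArcs (y ∷ b ++ [ x ])) (here refl)

  arcs-rotate : (xs ys : List A) → arcs (xs ++ ys) ↭ arcs (ys ++ xs)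
  arcs-rotate []       ys rewrite ++-identityʳ ys = ↭-refl
  arcs-rotate (x ∷ xs) [] rewrite ++-identityʳ xs = ↭-refl
  arcs-rotate (x ∷ xs) (y ∷ ys) rewrite arcs-++ x xs y ys | arcs-++ y ys x xs =
    ++-comm (pathArcs (x ∷ xs ++ [ y ])) (pathArcs (y ∷ ys ++ [ x ]))

  ∈-rotate : ∀ {x y : A} p q → x ≢ y → x ∈ p ++ y ∷ q → x ∈ q ++ p
  ∈-rotate p q x≢y x∈ with ∈-resp-↭ (++-comm p (_ ∷ q)) x∈
  ... | here x≡y  = contradiction x≡y x≢y
  ... | there x∈′ = x∈′

  length-shortcut< : (y : A) (b : List A) (x c₀ : A) (c : List A) →
                     length (y ∷ b ++ [ x ]) < length (y ∷ b ++ x ∷ c₀ ∷ c)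
  length-shortcut< y b x c₀ c rewrite length-++ b {[ x ]} | length-++ b {x ∷ c₀ ∷ c} =
    s≤s (+-monoʳ-< (length b) (s≤s (s≤s z≤n)))

  Unique-rotate : (xs ys : List A) → Unique (xs ++ ys) → Unique (ys ++ xs)
  Unique-rotate xs ys = Permutationₛ.Unique-resp-↭ (setoid A) (↭⇒↭ₛ (++-comm xs ys))

  Unique-++⁻ˡ : (xs : List A) {ys : List A} → Unique (xs ++ ys) → Unique xs
  Unique-++⁻ˡ []       _          = []
  Unique-++⁻ˡ (x ∷ xs) (x∉ ∷ u) = ++⁻ˡ xs x∉ ∷ Unique-++⁻ˡ xs u

  lookup-injective : ∀ {xs : List A} → Unique xs → ∀ {i j} → lookup xs i ≡ lookup xs j → i ≡ j
  lookup-injective (_ ∷ _)  {zero}  {zero}  _  = refl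
  lookup-injective (x∉ ∷ _) {zero}  {suc j} eq = contradiction eq (All.lookup x∉ (∈-lookup j))
  lookup-injective (x∉ ∷ _) {suc i} {zero}  eq = contradiction (sym eq) (All.lookup x∉ (∈-lookup i))
  lookup-injective (_ ∷ u)  {suc i} {suc j} eq = cong suc (lookup-injective u eq)

module _ {A : Set} {P Q : A → Set} (P? : Decidable P) (Q? : Decidable Q) (P⊆Q : P ⊆ Q) where

  filter-⊆-absorb : ∀ xs → filter P? (filter Q? xs) ≡ filter P? xs
  filter-⊆-absorb [] = refl
  filter-⊆-absorb (x ∷ xs) with Q? x
  ... | no ¬Qx = trans (filter-⊆-absorb xs) (sym (filter-reject P? (¬Qx ∘ P⊆Q)))
  ... | yes _ with P? x
  ...   | yes _ = cong (x ∷_) (filter-⊆-absorb xs)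
  ...   | no _  = filter-⊆-absorb xs

  length-filter-⊂ : ∀ {x} xs → x ∈ xs → Q x → ¬ P x → length (filter P? xs) < length (filter Q? xs)
  length-filter-⊂ xs x∈xs Qx ¬Px rewrite sym (filter-⊆-absorb xs) =
    filter-notAll P? (filter Q? xs) (lose (∈-filter⁺ Q? x∈xs Qx) ¬Px)

module _ {n : ℕ} where

  Unique⇒length≤ : {vs : List (Fin n)} → Unique vs → length vs ≤ n
  Unique⇒length≤ {vs} u = ≮⇒≥ λ n<length →
    let i , j , i<j , vsᵢ≡vsⱼ = pigeonhole n<length (lookup vs)
    in <⇒≢ i<j (lookup-injective u vsᵢ≡vsⱼ)

  ∃-length≤? : {P : List (Fin n) → Set} → Decidable P → ∀ k → Dec (∃ λ vs → length vs ≤ k × P vs)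
  ∃-length≤? P? k with P? []
  ... | yes P[] = yes ([] , z≤n , P[])
  ∃-length≤? P? zero    | no ¬P[] = no λ { ([] , _ , P[]) → ¬P[] P[] }
  ∃-length≤? P? (suc k) | no ¬P[] with any? (λ x → ∃-length≤? (P? ∘ (x ∷_)) k)
  ... | yes (x , ws , ws≤k , Pxws) = yes (x ∷ ws , s≤s ws≤k , Pxws)
  ... | no ¬∃ = no λ { ([] , _ , P[]) → ¬P[] P[] ; (x ∷ ws , s≤s ws≤k , Pxws) → ¬∃ (x , ws , ws≤k , Pxws) }

  _∈ᵛ?_ : (x : Fin n) (xs : List (Fin n)) → Dec (x ∈ xs)
  _∈ᵛ?_ = MembershipDec._∈?_ _≟ᶠ_

  _∈ᵃ?_ : (e : Fin n × Fin n) (es : List (Fin n × Fin n)) → Dec (e ∈ es)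
  _∈ᵃ?_ = MembershipDec._∈?_ (≡-dec _≟ᶠ_ _≟ᶠ_)

module _ {n : ℕ} {R : Fin n → Fin n → Set} where

  Chord : List (Fin n) → Set
  Chord C = ∃₂ λ x y → x ∈ C × y ∈ C × x ≢ y × R x y × (x , y) ∉ arcs C

  Chordless : List (Fin n) → Set
  Chordless C = ∀ x y → x ∈ C → y ∈ C → x ≢ y → R x y → (x , y) ∈ arcs C

  cycle-rotate : (xs ys : List (Fin n)) → IsCycleIn R (xs ++ ys) → IsCycleIn R (ys ++ xs)
  cycle-rotate xs ys (2≤length , u , arcsInR) =
    subst (2 ≤_) (↭-length (++-comm xs ys)) 2≤length ,
    Unique-rotate xs ys u ,
    All-resp-↭ (arcs-rotate xs ys) arcsInR

  cycle-shortcut : ∀ {x y} b c → IsCycleIn R (y ∷ b ++ x ∷ c) → R x y → IsCycleIn R (y ∷ b ++ [ x ])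
  cycle-shortcut {x} {y} b c (_ , u , arcsInR) Rxy = 2≤length , uniqueN , arcsNInR
    where
    2≤length : 2 ≤ length (y ∷ b ++ [ x ])
    2≤length = s≤s (subst (1 ≤_) (sym (length-++ b)) (m≤n+m 1 (length b)))
    uniqueN : Unique (y ∷ b ++ [ x ])
    uniqueN = Unique-++⁻ˡ (y ∷ b ++ [ x ]) (subst Unique (sym (++-assoc (y ∷ b) [ x ] c)) u)
    arcsNInR : All (uncurry R) (arcs (y ∷ b ++ [ x ]))
    arcsNInR rewrite arcs-++ y b x [] =
      ++⁺ (++⁻ˡ (pathArcs (y ∷ b ++ [ x ])) (subst (All (uncurry R)) (arcs-++ y b x c) arcsInR)) (Rxy ∷ [])

  chord-shortens-at-head : ∀ {x y} L → IsCycleIn R (y ∷ L) → x ∈ L → R x y → (x , y) ∉ arcs (y ∷ L) →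
                           ∃ λ N → IsCycleIn R N × length N < length (y ∷ L)
  chord-shortens-at-head {x} {y} L cyc x∈L Rxy xy∉C with ∈-∃++ x∈L
  ... | b , []     , refl = contradiction (closing-arc y b x) xy∉C
  ... | b , c₀ ∷ c , refl = _ , cycle-shortcut b (c₀ ∷ c) cyc Rxy , length-shortcut< y b x c₀ c

  chord-shortens : ∀ {C} → IsCycleIn R C → Chord C → ∃ λ N → IsCycleIn R N × length N < length C
  chord-shortens cyc (x , y , x∈C , y∈C , x≢y , Rxy , xy∉C) with ∈-∃++ y∈C
  ... | p , q , refl =
    let N , cycN , N<C = chord-shortens-at-head (q ++ p) (cycle-rotate p (y ∷ q) cyc) (∈-rotate p q x≢y x∈C)
                                                 Rxy (xy∉C ∘ ∈-resp-↭ (arcs-rotate (y ∷ q) p))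
    in N , cycN , subst (length N <_) (↭-length (++-comm (y ∷ q) p)) N<C

  module _ (R? : Decidable₂ R) where

    cycle? : Decidable (IsCycleIn R)
    cycle? vs = (2 ≤? length vs) ×-dec (UniqueDec.unique? _≟ᶠ_ vs ×-dec All.all? (uncurry R?) (arcs vs))

    hasCycle? : Dec (HasCycle R)
    hasCycle? with ∃-length≤? cycle? n
    ... | yes (vs , _ , cyc) = yes (vs , cyc)
    ... | no ¬∃ = no λ (vs , cyc@(_ , u , _)) → ¬∃ (vs , Unique⇒length≤ u , cyc)

    chord? : Decidable Chord
    chord? C = any? λ x → any? λ y →
      (x ∈ᵛ? C) ×-dec (y ∈ᵛ? C) ×-dec ¬? (x ≟ᶠ y) ×-dec R? x y ×-dec ¬? ((x , y) ∈ᵃ? arcs C)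

    chordless-cycle : ∀ {C} → Acc _<_ (length C) → IsCycleIn R C → ∃ λ C' → IsCycleIn R C' × Chordless C'
    chordless-cycle {C} (acc shorter) cyc with chord? C
    ... | yes chord = let N , cycN , N<C = chord-shortens cyc chord in chordless-cycle (shorter N<C) cycN
    ... | no ¬chord = C , cyc , λ x y x∈C y∈C x≢y Rxy →
      decidable-stable ((x , y) ∈ᵃ? arcs C) (λ xy∉C → ¬chord (x , y , x∈C , y∈C , x≢y , Rxy , xy∉C))

    HasCycle⇒chordless : HasCycle R → ∃ λ C → IsCycleIn R C × Chordless C
    HasCycle⇒chordless (C , cyc) = chordless-cycle (<-wellFounded (length C)) cyc

module _ {n : ℕ} (D : Digraph n) where

  EdgelessOnMembers : List (List (Fin n)) → Set
  EdgelessOnMembers F = ∀ C → C ∈ F → ∀ x y → x ∈ C → y ∈ C → x ≢ y → ¬ RemEdge D F x y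

  covered? : (F : List (List (Fin n))) → Decidable₂ (Covered F)
  covered? F x y = Any.any? (λ C → (x , y) ∈ᵃ? arcs C) F

  remEdge? : ∀ F → Decidable₂ (RemEdge D F)
  remEdge? F x y = edge? D x y ×-dec ¬? (covered? F x y)

  remainingEdges : List (List (Fin n)) → List (Fin n × Fin n)
  remainingEdges F = filter (uncurry (remEdge? F)) (cartesianProduct (allFin n) (allFin n))

  remEdge-∷⁻ : ∀ {C F x y} → RemEdge D (C ∷ F) x y → RemEdge D F x y
  remEdge-∷⁻ (Exy , ¬covered) = Exy , ¬covered ∘ there

  family-∷ : ∀ {F C} → IsCycleFamily D F → IsCycleIn (RemEdge D F) C → IsCycleFamily D (C ∷ F)
  family-∷ (cycles , disjoint) (2≤length , u , arcsRemain) =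
    (2≤length , u , All.map proj₁ arcsRemain) ∷ cycles ,
    All.tabulate (λ C'∈F x y xy∈C xy∈C' → proj₂ (All.lookup arcsRemain xy∈C) (lose C'∈F xy∈C')) ∷ disjoint

  edgeless-∷ : ∀ {F C} → EdgelessOnMembers F → Chordless {R = RemEdge D F} C → EdgelessOnMembers (C ∷ F)
  edgeless-∷ _        chordless C (here refl)  x y x∈C y∈C x≢y rem =
    proj₂ rem (here (chordless x y x∈C y∈C x≢y (remEdge-∷⁻ rem)))
  edgeless-∷ edgeless _         C (there C∈F) x y x∈C y∈C x≢y rem =
    edgeless C C∈F x y x∈C y∈C x≢y (remEdge-∷⁻ rem)

  remainingEdges-∷ : ∀ {F C} → IsCycleIn (RemEdge D F) C → length (remainingEdges (C ∷ F)) < length (remainingEdges F)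
  remainingEdges-∷ {F} {a ∷ b ∷ _} (_ , _ , remab ∷ _) =
    length-filter-⊂ (uncurry (remEdge? (_ ∷ F))) (uncurry (remEdge? F)) remEdge-∷⁻
      (cartesianProduct (allFin n) (allFin n)) (∈-cartesianProduct⁺ (∈-allFin a) (∈-allFin b))
      remab (λ rem → proj₂ rem (here (here refl)))
  remainingEdges-∷ {C = _ ∷ []} (s≤s () , _)

  maximal-extension : ∀ F → Acc _<_ (length (remainingEdges F)) → IsCycleFamily D F → EdgelessOnMembers F →
                      ∃ λ F' → IsMaximalCycleFamily D F' × EdgelessOnMembers F'
  maximal-extension F (acc smaller) family edgeless with hasCycle? (remEdge? F)
  ... | no acyclic = F , (family , acyclic) , edgeless
  ... | yes cycle =
    let C , cycC , chordless = HasCycle⇒chordless (remEdge? F) cycle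
    in maximal-extension (C ∷ F) (smaller (remainingEdges-∷ cycC)) (family-∷ family cycC) (edgeless-∷ edgeless chordless)

proposition3p5 : {n : ℕ} (D : Digraph n) →
    ∃ λ (F : List (List (Fin n))) →
      IsMaximalCycleFamily D F ×
      (∀ C → C ∈ F → ∀ x y → x ∈ C → y ∈ C → x ≢ y → ¬ RemEdge D F x y)
proposition3p5 D = maximal-extension D [] (<-wellFounded _) ([] , []) (λ _ ())
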